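{- For a positive integer $m$, let $h_{\mathcal{D}}(m)$ be the number of partitions $\pi$ into distinct parts with $\Gamma(\pi)=m$, and let $h_{\mathcal{D},\mathcal{E}}(m)$ (resp. $h_{\mathcal{D},\mathcal{O}}(m)$) be the number of those with an even (resp. odd) number of parts. Then for all positive integers $n$: $h_{\mathcal{D}}(3n)\equiv0\pmod 2$, $h_{\mathcal{D}}(4n)\equiv0\pmod 3$, $h_{\mathcal{D}}(5n)\equiv0\pmod5$, $h_{\mathcal{D}}(6n)\equiv0\pmod 8$; for all integers $n\ge0$, $h_{\mathcal{D}}(6n+3)\equiv2\pmod{16}$; for all positive integers $n$, $h_{\mathcal{D},\mathcal{O}}(6n)=h_{\mathcal{D},\mathcal{E}}(6n)\equiv0\pmod4$; and for all integers $n\ge0$, $h_{\mathcal{D},\mathcal{O}}(6n+3)=h_{\mathcal{D},\mathcal{E}}(6n+3)\equiv1\pmod 8$.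
   Context: For a non-empty partition $\pi=(\pi_1\ge\cdots\ge\pi_r\ge1)$, $\ell(\pi)=r$ and $\Gamma(\pi)=\pi_1+\ell(\pi)-1$ (length of the largest hook). -}

module Defs where

open import Data.Nat using (ℕ; zero; suc; _+_; _∸_; _≟_; _<_)
open import Data.Nat.DivMod using (_%_)
open import Data.List using (List; []; _∷_; length; filter; map; _++_)
open import Relation.Nullary using (¬?)
open import Relation.Binary.PropositionalEquality using (_≡_)

-- A partition is represented as a list of its parts in weakly decreasing order.
-- A partition into DISTINCT parts is a strictly decreasing list of positive integers.

-- Γ(π) = π₁ + ℓ(π) - 1 (length of the largest hook); only meaningful for
-- non-empty π (we set Γ([]) = 0, never used since we only enumerate non-empty π).
Γ : List ℕ → ℕ
Γ [] = 0
Γ (p ∷ ps) = p + length ps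

distinctUpTo : ℕ → List (List ℕ)
distinctUpTo zero = [] ∷ []
distinctUpTo (suc b) = distinctUpTo b ++ map (suc b ∷_) (distinctUpTo b)

nonEmpty : List ℕ → List (List ℕ)
nonEmpty [] = []
nonEmpty (x ∷ xs) = (x ∷ xs) ∷ []

concatMapL : (List ℕ → List (List ℕ)) → List (List ℕ) → List (List ℕ)
concatMapL f [] = []
concatMapL f (x ∷ xs) = f x ++ concatMapL f xs

distinctPartitionsUpTo : ℕ → List (List ℕ)
distinctPartitionsUpTo b = concatMapL nonEmpty (distinctUpTo b)

-- Every non-empty distinct partition π with Γ(π) = m has π₁ ≤ m, so the
-- partitions into distinct parts with Γ(π) = m are exactly these:
distinctWithΓ : ℕ → List (List ℕ)
distinctWithΓ m = filter (λ π → Γ π ≟ m) (distinctPartitionsUpTo m)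

hD : ℕ → ℕ
hD m = length (distinctWithΓ m)

hDE : ℕ → ℕ
hDE m = length (filter (λ π → (length π % 2 ≟ 0)) (distinctWithΓ m))

hDO : ℕ → ℕ
hDO m = length (filter (λ π → length π % 2 ≟ 1) (distinctWithΓ m))

-- Split the partitions π with Γ(π) = m + 2 according to whether the part just below
-- the largest one is present.  If it is absent, lowering the largest part by one gives
-- Γ = m + 1 with the same number of parts; if it is present, deleting the largest part
-- gives Γ = m with one part fewer.  Hence h_D is the Fibonacci sequence, and the counts
-- with an odd and an even number of parts obey h_O(m+2) = h_O(m+1) + h_E(m) and
-- symmetrically; so h_O − h_E changes sign every three steps, and as it vanishes at
-- m = 3 it vanishes at every multiple of 3.  The congruences for h_D follow from
-- F_k ∣ F_{kn} and from the Pisano period 24 of F modulo 16; those for h_E follow by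
-- halving h_D = 2 h_E.
module Submission where

open import Defs
open import Data.Bool using (Bool; true; false; _∧_; if_then_else_)
open import Data.Bool.Properties using (∧-identityʳ)
open import Data.List using (List; []; _∷_; length; filter; map; _++_)
open import Data.Nat using (ℕ; zero; suc; _+_; _*_; _≟_; _≡ᵇ_; NonZero)
open import Data.Nat.DivMod using (_%_; %-distribˡ-*; %-remove-+ˡ; m%n%n≡m%n; m%n*o≡m*o%[n*o])
open import Data.Nat.Divisibility
  using (_∣_; _∣0; n∣m*n; ∣m⇒∣m*n; ∣n⇒∣m*n; ∣m∣n⇒∣m+n; n∣m⇒m%n≡0; m%n≡0⇒n∣m)
open import Data.Nat.Properties
  using (+-suc; *-suc; +-comm; *-comm; +-identityʳ; *-identityʳ; +-cancelʳ-≡; *-cancelʳ-≡;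
         +-commutativeSemigroup)
open import Data.Nat.Solver using (module +-*-Solver)
open import Algebra.Properties.CommutativeSemigroup +-commutativeSemigroup using (interchange)
open import Data.Product using (_×_; _,_)
open import Function using (_∘_)
open import Relation.Nullary using (does)
open import Relation.Unary using (Decidable)
open import Relation.Binary.PropositionalEquality
  using (_≡_; refl; sym; trans; cong; cong₂; subst; _≗_; module ≡-Reasoning)

open +-*-Solver using (solve; _:+_; _:*_; _:=_; con)

private
  variable
    A : Set

count : (A → Bool) → List A → ℕ
count p []       = 0
count p (x ∷ xs) = if p x then suc (count p xs) else count p xs

length-filter≡count : ∀ {p} {P : A → Set p} (P? : Decidable P) xs →
                      length (filter P? xs) ≡ count (does ∘ P?) xs
length-filter≡count P? []       = refl
length-filter≡count P? (x ∷ xs) with does (P? x)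
... | true  = cong suc (length-filter≡count P? xs)
... | false = length-filter≡count P? xs

count-filter : ∀ {q} {Q : A → Set q} (Q? : Decidable Q) p xs →
               count p (filter Q? xs) ≡ count (λ x → does (Q? x) ∧ p x) xs
count-filter Q? p []       = refl
count-filter Q? p (x ∷ xs) with does (Q? x)
... | false = count-filter Q? p xs
... | true with p x
...   | true  = cong suc (count-filter Q? p xs)
...   | false = count-filter Q? p xs

count-++ : ∀ (p : A → Bool) xs ys → count p (xs ++ ys) ≡ count p xs + count p ys
count-++ p []       ys = refl
count-++ p (x ∷ xs) ys with p x
... | true  = cong suc (count-++ p xs ys)
... | false = count-++ p xs ys

count-map : ∀ {B : Set} (p : B → Bool) (f : A → B) xs → count p (map f xs) ≡ count (p ∘ f) xs
count-map p f []       = refl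
count-map p f (x ∷ xs) with p (f x)
... | true  = cong suc (count-map p f xs)
... | false = count-map p f xs

count-cong : ∀ {p q : A → Bool} → p ≗ q → ∀ xs → count p xs ≡ count q xs
count-cong p≗q []       = refl
count-cong {q = q} p≗q (x ∷ xs) rewrite p≗q x with q x
... | true  = cong suc (count-cong p≗q xs)
... | false = count-cong p≗q xs

count-none : ∀ {p : A → Bool} → (∀ x → p x ≡ false) → ∀ xs → count p xs ≡ 0
count-none none []       = refl
count-none none (x ∷ xs) rewrite none x = count-none none xs

suc-m+n≢ᵇm : ∀ m n → (suc m + n ≡ᵇ m) ≡ false
suc-m+n≢ᵇm zero    n = refl
suc-m+n≢ᵇm (suc m) n = suc-m+n≢ᵇm m n

fib : ℕ → ℕ
fib zero          = 0
fib (suc zero)    = 1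
fib (suc (suc n)) = fib (suc n) + fib n

fib-unique : (f : ℕ → ℕ) → f 1 ≡ 1 → f 2 ≡ 1 → (∀ t → f (3 + t) ≡ f (2 + t) + f (1 + t)) →
             ∀ m → f (suc m) ≡ fib (suc m)
fib-unique f f1 f2 rec zero          = f1
fib-unique f f1 f2 rec (suc zero)    = f2
fib-unique f f1 f2 rec (suc (suc m)) =
  trans (rec m) (cong₂ _+_ (fib-unique f f1 f2 rec (suc m)) (fib-unique f f1 f2 rec m))

fib-+ : ∀ m n → fib (m + suc n) ≡ fib (suc m) * fib (suc n) + fib m * fib n
fib-+ zero          n = solve 2 (λ a b → a := con 1 :* a :+ con 0 :* b) refl (fib (suc n)) (fib n)
fib-+ (suc zero)    n = solve 2 (λ a b → a :+ b := con 1 :* a :+ con 1 :* b) refl (fib (suc n)) (fib n)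
fib-+ (suc (suc m)) n rewrite fib-+ (suc m) n | fib-+ m n =
  solve 5 (λ x y z a b → (x :* a :+ y :* b) :+ (y :* a :+ z :* b) := ((x :+ y) :* a :+ (y :+ z) :* b))
        refl (fib (2 + m)) (fib (1 + m)) (fib m) (fib (suc n)) (fib n)

fib[m]∣fib[m*n] : ∀ m n → fib m ∣ fib (m * n)
fib[m]∣fib[m*n] zero    n = 0 ∣0
fib[m]∣fib[m*n] (suc k) zero    rewrite *-comm k 0 = fib (suc k) ∣0
fib[m]∣fib[m*n] (suc k) (suc n) rewrite *-suc (suc k) n | +-comm (suc k) (suc k * n) | fib-+ (suc k * n) k =
  ∣m∣n⇒∣m+n (n∣m*n (fib (suc (suc k * n)))) (∣m⇒∣m*n (fib k) (fib[m]∣fib[m*n] (suc k) n))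

fib-periodic : ∀ M .{{_ : NonZero M}} q → fib (suc q) % M ≡ 0 → fib q % M ≡ 1 →
               ∀ m → fib (m + suc q) % M ≡ fib m % M
fib-periodic M q F[q+1]≡0 F[q]≡1 m = begin
  fib (m + suc q) % M
    ≡⟨ cong (_% M) (fib-+ m q) ⟩
  (fib (suc m) * fib (suc q) + fib m * fib q) % M
    ≡⟨ %-remove-+ˡ _ (∣n⇒∣m*n (fib (suc m)) ∣F[q+1]) ⟩
  fib m * fib q % M
    ≡⟨ %-distribˡ-* (fib m) (fib q) M ⟩
  fib m % M * (fib q % M) % M
    ≡⟨ cong (λ r → fib m % M * r % M) F[q]≡1 ⟩
  fib m % M * 1 % M
    ≡⟨ cong (_% M) (*-identityʳ (fib m % M)) ⟩
  fib m % M % M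
    ≡⟨ m%n%n≡m%n (fib m) M ⟩
  fib m % M ∎
  where
  open ≡-Reasoning
  ∣F[q+1] : M ∣ fib (suc q)
  ∣F[q+1] = m%n≡0⇒n∣m (fib (suc q)) M F[q+1]≡0

fib[k*n]%fib[k]≡0 : ∀ k n .{{_ : NonZero (fib k)}} → fib (k * n) % fib k ≡ 0
fib[k*n]%fib[k]≡0 k n = n∣m⇒m%n≡0 (fib (k * n)) (fib k) (fib[m]∣fib[m*n] k n)

-- The Pisano period of 16 is 24, so four initial values suffice.
fib[6n+3]%16≡2 : ∀ n → fib (6 * n + 3) % 16 ≡ 2
fib[6n+3]%16≡2 0 = refl
fib[6n+3]%16≡2 1 = refl
fib[6n+3]%16≡2 2 = refl
fib[6n+3]%16≡2 3 = refl
fib[6n+3]%16≡2 (suc (suc (suc (suc n)))) = begin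
  fib (6 * (4 + n) + 3) % 16  ≡⟨ cong (λ m → fib m % 16) (shift n) ⟩
  fib (6 * n + 3 + 24) % 16   ≡⟨ fib-periodic 16 23 refl refl (6 * n + 3) ⟩
  fib (6 * n + 3) % 16        ≡⟨ fib[6n+3]%16≡2 n ⟩
  2                           ∎
  where
  open ≡-Reasoning
  shift : ∀ n → 6 * (4 + n) + 3 ≡ 6 * n + 3 + 24
  shift = solve 1 (λ n → con 6 :* (con 4 :+ n) :+ con 3 := (con 6 :* n :+ con 3) :+ con 24) refl

%-halve : ∀ M .{{_ : NonZero M}} .{{_ : NonZero (M * 2)}} x r → x * 2 % (M * 2) ≡ r * 2 → x % M ≡ r
%-halve M x r eq = *-cancelʳ-≡ (x % M) r 2 (trans (m%n*o≡m*o%[n*o] x M 2) eq)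


distinctPartitionsUpTo-suc : ∀ b → distinctPartitionsUpTo (suc b) ≡
                             distinctPartitionsUpTo b ++ map (suc b ∷_) (distinctUpTo b)
distinctPartitionsUpTo-suc b =
  trans (concatMapL-++ (distinctUpTo b) _) (cong (distinctPartitionsUpTo b ++_) (concatMapL-cons _))
  where
  concatMapL-++ : ∀ xss yss → concatMapL nonEmpty (xss ++ yss) ≡
                              concatMapL nonEmpty xss ++ concatMapL nonEmpty yss
  concatMapL-++ []              yss = refl
  concatMapL-++ ([] ∷ xss)      yss = concatMapL-++ xss yss
  concatMapL-++ ((x ∷ xs) ∷ xss) yss = cong ((x ∷ xs) ∷_) (concatMapL-++ xss yss)

  concatMapL-cons : ∀ xss → concatMapL nonEmpty (map (suc b ∷_) xss) ≡ map (suc b ∷_) xss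
  concatMapL-cons []         = refl
  concatMapL-cons (xs ∷ xss) = cong ((suc b ∷ xs) ∷_) (concatMapL-cons xss)

-- The tails of the partitions with largest part b + 1 and Γ = t + 1.
tailCount : (ℕ → Bool) → ℕ → ℕ → ℕ
tailCount P b t = count (λ ps → (b + length ps ≡ᵇ t) ∧ P (length ps)) (distinctUpTo b)

partsCount : (ℕ → Bool) → ℕ → ℕ → ℕ
partsCount P B m = count (λ π → (Γ π ≡ᵇ m) ∧ P (length π)) (distinctPartitionsUpTo B)

hookCount : (ℕ → Bool) → ℕ → ℕ
hookCount P m = partsCount P m m

tailCount-suc : ∀ P b t →
  tailCount P (suc b) (suc (suc t)) ≡ tailCount P b (suc t) + tailCount (P ∘ suc) b t
tailCount-suc P b t = begin
  tailCount P (suc b) (suc (suc t))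
    ≡⟨ count-++ _ (distinctUpTo b) _ ⟩
  tailCount P b (suc t) + count _ (map (suc b ∷_) (distinctUpTo b))
    ≡⟨ cong (tailCount P b (suc t) +_) (count-map _ (suc b ∷_) (distinctUpTo b)) ⟩
  tailCount P b (suc t) + count (λ ps → (b + suc (length ps) ≡ᵇ suc t) ∧ P (suc (length ps)))
                                (distinctUpTo b)
    ≡⟨ cong (tailCount P b (suc t) +_) (count-cong lower (distinctUpTo b)) ⟩
  tailCount P b (suc t) + tailCount (P ∘ suc) b t ∎
  where
  open ≡-Reasoning
  lower : (λ ps → (b + suc (length ps) ≡ᵇ suc t) ∧ P (suc (length ps))) ≗
          (λ ps → (b + length ps ≡ᵇ t) ∧ P (suc (length ps)))
  lower ps = cong (λ n → (n ≡ᵇ suc t) ∧ P (suc (length ps))) (+-suc b (length ps))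

tailCount-beyond : ∀ P t → tailCount P (suc t) t ≡ 0
tailCount-beyond P t = count-none (λ ps → cong (_∧ P (length ps)) (suc-m+n≢ᵇm t (length ps)))
                                  (distinctUpTo (suc t))

partsCount-suc : ∀ P B t →
  partsCount P (suc B) (suc t) ≡ partsCount P B (suc t) + tailCount (P ∘ suc) B t
partsCount-suc P B t = begin
  partsCount P (suc B) (suc t)
    ≡⟨ cong (count _) (distinctPartitionsUpTo-suc B) ⟩
  count _ (distinctPartitionsUpTo B ++ map (suc B ∷_) (distinctUpTo B))
    ≡⟨ count-++ _ (distinctPartitionsUpTo B) _ ⟩
  partsCount P B (suc t) + count _ (map (suc B ∷_) (distinctUpTo B))
    ≡⟨ cong (partsCount P B (suc t) +_) (count-map _ (suc B ∷_) (distinctUpTo B)) ⟩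
  partsCount P B (suc t) + tailCount (P ∘ suc) B t ∎
  where open ≡-Reasoning

partsCount-recurrence : ∀ P B t →
  partsCount P (suc B) (3 + t) ≡ partsCount P B (2 + t) + partsCount (P ∘ suc) B (1 + t)
partsCount-recurrence P zero    t = refl
partsCount-recurrence P (suc B) t = begin
  partsCount P (2 + B) (3 + t)
    ≡⟨ partsCount-suc P (suc B) (2 + t) ⟩
  partsCount P (suc B) (3 + t) + tailCount (P ∘ suc) (suc B) (2 + t)
    ≡⟨ cong₂ _+_ (partsCount-recurrence P B t) (tailCount-suc (P ∘ suc) B t) ⟩
  (partsCount P B (2 + t) + partsCount (P ∘ suc) B (1 + t)) +
  (tailCount (P ∘ suc) B (1 + t) + tailCount (P ∘ suc ∘ suc) B t)
    ≡⟨ interchange (partsCount P B (2 + t)) (partsCount (P ∘ suc) B (1 + t))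
                   (tailCount (P ∘ suc) B (1 + t)) (tailCount (P ∘ suc ∘ suc) B t) ⟩
  (partsCount P B (2 + t) + tailCount (P ∘ suc) B (1 + t)) +
  (partsCount (P ∘ suc) B (1 + t) + tailCount (P ∘ suc ∘ suc) B t)
    ≡⟨ sym (cong₂ _+_ (partsCount-suc P B (1 + t)) (partsCount-suc (P ∘ suc) B t)) ⟩
  partsCount P (suc B) (2 + t) + partsCount (P ∘ suc) (suc B) (1 + t) ∎
  where open ≡-Reasoning

hookCount-recurrence : ∀ P t →
  hookCount P (3 + t) ≡ hookCount P (2 + t) + hookCount (P ∘ suc) (1 + t)
hookCount-recurrence P t = begin
  hookCount P (3 + t)
    ≡⟨ partsCount-recurrence P (2 + t) t ⟩
  hookCount P (2 + t) + partsCount (P ∘ suc) (2 + t) (1 + t)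
    ≡⟨ cong (hookCount P (2 + t) +_) (partsCount-suc (P ∘ suc) (1 + t) t) ⟩
  hookCount P (2 + t) + (hookCount (P ∘ suc) (1 + t) + tailCount (P ∘ suc ∘ suc) (1 + t) t)
    ≡⟨ cong (λ n → hookCount P (2 + t) + (hookCount (P ∘ suc) (1 + t) + n))
            (tailCount-beyond (P ∘ suc ∘ suc) t) ⟩
  hookCount P (2 + t) + (hookCount (P ∘ suc) (1 + t) + 0)
    ≡⟨ cong (hookCount P (2 + t) +_) (+-identityʳ _) ⟩
  hookCount P (2 + t) + hookCount (P ∘ suc) (1 + t) ∎
  where open ≡-Reasoning

hookCount-cong : ∀ {P Q} → P ≗ Q → ∀ m → hookCount P m ≡ hookCount Q m
hookCount-cong P≗Q m =
  count-cong (λ π → cong ((Γ π ≡ᵇ m) ∧_) (P≗Q (length π))) (distinctPartitionsUpTo m)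

hD≡hookCount : ∀ m → hD m ≡ hookCount (λ _ → true) m
hD≡hookCount m =
  trans (length-filter≡count (λ π → Γ π ≟ m) (distinctPartitionsUpTo m))
        (count-cong (λ π → sym (∧-identityʳ (Γ π ≡ᵇ m))) (distinctPartitionsUpTo m))

parityCount≡hookCount : ∀ r m →
  length (filter (λ π → length π % 2 ≟ r) (distinctWithΓ m)) ≡ hookCount (λ n → n % 2 ≡ᵇ r) m
parityCount≡hookCount r m =
  trans (length-filter≡count (λ π → length π % 2 ≟ r) (distinctWithΓ m))
        (count-filter (λ π → Γ π ≟ m) (λ π → length π % 2 ≡ᵇ r) (distinctPartitionsUpTo m))

even-suc : ∀ n → (suc n % 2 ≡ᵇ 0) ≡ (n % 2 ≡ᵇ 1)
even-suc zero          = refl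
even-suc (suc zero)    = refl
even-suc (suc (suc n)) = even-suc n

odd-suc : ∀ n → (suc n % 2 ≡ᵇ 1) ≡ (n % 2 ≡ᵇ 0)
odd-suc zero          = refl
odd-suc (suc zero)    = refl
odd-suc (suc (suc n)) = odd-suc n

hD-recurrence : ∀ t → hD (3 + t) ≡ hD (2 + t) + hD (1 + t)
hD-recurrence t rewrite hD≡hookCount (3 + t) | hD≡hookCount (2 + t) | hD≡hookCount (1 + t) =
  hookCount-recurrence (λ _ → true) t

hDE-recurrence : ∀ t → hDE (3 + t) ≡ hDE (2 + t) + hDO (1 + t)
hDE-recurrence t
  rewrite parityCount≡hookCount 0 (3 + t) | parityCount≡hookCount 0 (2 + t)
        | parityCount≡hookCount 1 (1 + t)
  = trans (hookCount-recurrence (λ n → n % 2 ≡ᵇ 0) t)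
          (cong (hookCount (λ n → n % 2 ≡ᵇ 0) (2 + t) +_) (hookCount-cong even-suc (1 + t)))

hDO-recurrence : ∀ t → hDO (3 + t) ≡ hDO (2 + t) + hDE (1 + t)
hDO-recurrence t
  rewrite parityCount≡hookCount 1 (3 + t) | parityCount≡hookCount 1 (2 + t)
        | parityCount≡hookCount 0 (1 + t)
  = trans (hookCount-recurrence (λ n → n % 2 ≡ᵇ 1) t)
          (cong (hookCount (λ n → n % 2 ≡ᵇ 1) (2 + t) +_) (hookCount-cong odd-suc (1 + t)))

hD≡fib : ∀ m → hD m ≡ fib m
hD≡fib zero    = refl
hD≡fib (suc m) = fib-unique hD refl refl hD-recurrence m

hDE+hDO≡fib : ∀ m → hDE m + hDO m ≡ fib m
hDE+hDO≡fib zero    = refl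
hDE+hDO≡fib (suc m) = fib-unique (λ m → hDE m + hDO m) refl refl recurrence m
  where
  recurrence : ∀ t → hDE (3 + t) + hDO (3 + t) ≡ (hDE (2 + t) + hDO (2 + t)) + (hDE (1 + t) + hDO (1 + t))
  recurrence t rewrite hDE-recurrence t | hDO-recurrence t =
    solve 4 (λ e₂ o₂ e₁ o₁ → (e₂ :+ o₁) :+ (o₂ :+ e₁) := (e₂ :+ o₂) :+ (e₁ :+ o₁))
          refl (hDE (2 + t)) (hDO (2 + t)) (hDE (1 + t)) (hDO (1 + t))

hDO-hDE-balance : ∀ t → hDO (4 + t) + hDO (1 + t) ≡ hDE (4 + t) + hDE (1 + t)
hDO-hDE-balance t
  rewrite hDO-recurrence (1 + t) | hDE-recurrence (1 + t) | hDO-recurrence t | hDE-recurrence t =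
  solve 4 (λ e₂ o₂ e₁ o₁ → ((o₂ :+ e₁) :+ e₂) :+ o₁ := ((e₂ :+ o₁) :+ o₂) :+ e₁)
        refl (hDE (2 + t)) (hDO (2 + t)) (hDE (1 + t)) (hDO (1 + t))

hDO≡hDE : ∀ k → hDO (3 + 3 * k) ≡ hDE (3 + 3 * k)
hDO≡hDE zero    = refl
hDO≡hDE (suc k) = subst (λ m → hDO m ≡ hDE m) (cong (3 +_) (sym (*-suc 3 k)))
  (+-cancelʳ-≡ (hDO (3 + 3 * k)) (hDO (6 + 3 * k)) (hDE (6 + 3 * k))
    (trans (hDO-hDE-balance (2 + 3 * k)) (cong (hDE (6 + 3 * k) +_) (sym (hDO≡hDE k)))))

hDE*2≡fib : ∀ m → hDO m ≡ hDE m → hDE m * 2 ≡ fib m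
hDE*2≡fib m balanced = begin
  hDE m * 2            ≡⟨ *-comm (hDE m) 2 ⟩
  hDE m + (hDE m + 0)  ≡⟨ cong (hDE m +_) (trans (+-identityʳ (hDE m)) (sym balanced)) ⟩
  hDE m + hDO m        ≡⟨ hDE+hDO≡fib m ⟩
  fib m                ∎
  where open ≡-Reasoning

hDE%M≡r : ∀ m M .{{_ : NonZero M}} .{{_ : NonZero (M * 2)}} r →
          hDO m ≡ hDE m → fib m % (M * 2) ≡ r * 2 → hDE m % M ≡ r
hDE%M≡r m M r balanced fib[m]%2M≡2r =
  %-halve M (hDE m) r (trans (cong (_% (M * 2)) (hDE*2≡fib m balanced)) fib[m]%2M≡2r)

hD[k*n]%fib[k]≡0 : ∀ k n .{{_ : NonZero (fib k)}} → hD (k * n) % fib k ≡ 0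
hD[k*n]%fib[k]≡0 k n = trans (cong (_% fib k) (hD≡fib (k * n))) (fib[k*n]%fib[k]≡0 k n)

hDO≡hDE-at : ∀ m k → m ≡ 3 + 3 * k → hDO m ≡ hDE m
hDO≡hDE-at _ k refl = hDO≡hDE k

mainTheorem12 : (∀ (n : ℕ) → hD (3 * suc n) % 2 ≡ 0)
    × (∀ (n : ℕ) → hD (4 * suc n) % 3 ≡ 0)
    × (∀ (n : ℕ) → hD (5 * suc n) % 5 ≡ 0)
    × (∀ (n : ℕ) → hD (6 * suc n) % 8 ≡ 0)
    × (∀ (n : ℕ) → hD (6 * n + 3) % 16 ≡ 2)
    × (∀ (n : ℕ) → (hDO (6 * suc n) ≡ hDE (6 * suc n)) × (hDE (6 * suc n) % 4 ≡ 0))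
    × (∀ (n : ℕ) → (hDO (6 * n + 3) ≡ hDE (6 * n + 3)) × (hDE (6 * n + 3) % 8 ≡ 1))
mainTheorem12 =
    (λ n → hD[k*n]%fib[k]≡0 3 (suc n))
  , (λ n → hD[k*n]%fib[k]≡0 4 (suc n))
  , (λ n → hD[k*n]%fib[k]≡0 5 (suc n))
  , (λ n → hD[k*n]%fib[k]≡0 6 (suc n))
  , (λ n → trans (cong (_% 16) (hD≡fib (6 * n + 3))) (fib[6n+3]%16≡2 n))
  , (λ n → let balanced = hDO≡hDE-at (6 * suc n) (1 + 2 * n) (6[n+1]≡3+3k n) in
       balanced , hDE%M≡r (6 * suc n) 4 0 balanced (fib[k*n]%fib[k]≡0 6 (suc n)))
  , (λ n → let balanced = hDO≡hDE-at (6 * n + 3) (2 * n) (6n+3≡3+3k n) in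
       balanced , hDE%M≡r (6 * n + 3) 8 1 balanced (fib[6n+3]%16≡2 n))
  where
  6[n+1]≡3+3k : ∀ n → 6 * suc n ≡ 3 + 3 * (1 + 2 * n)
  6[n+1]≡3+3k = solve 1 (λ n → con 6 :* (con 1 :+ n) := con 3 :+ con 3 :* (con 1 :+ con 2 :* n)) refl
  6n+3≡3+3k : ∀ n → 6 * n + 3 ≡ 3 + 3 * (2 * n)
  6n+3≡3+3k = solve 1 (λ n → con 6 :* n :+ con 3 := con 3 :+ con 3 :* (con 2 :* n)) refl
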